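{- Let $n<\omega$ and let $T,T'$ be sets each of size at least $2^{n+1}$. Then $\exists$ has a winning strategy in the Seurat game for sets $\mathbf G_n(T,T')$.
   Context: The $n$-round Seurat game for sets $\mathbf G_n(T,T')$ is played by $\forall$ and $\exists$. If $n=0$ no moves are made. Otherwise a play is a sequence $((T_0,T'_0),\dots,(T_{n-1},T'_{n-1}))$ with $T_i\subseteq T$, $T'_i\subseteq T'$; positions are its initial segments, the initial position $p_0$ being empty. In round $i<n$, $\forall$ chooses either a subset $T_i\subseteq T$ or a subset $T'_i\subseteq T'$, $\exists$ chooses a subset of the other set, and $p_{i+1}$ is $p_i$ with $(T_i,T'_i)$ appended. A palette is a subset $\pi\subseteq\{i:i<n\}$. For a position $p_i=((T_0,T'_0),\dots,(T_{i-1},T'_{i-1}))$ with $i>0$, set $\pi^{p_i}_T=\{x\in T:\forall j<i\,(x\in T_j\iff j\in\pi)\}$ and $\pi^{p_i}_{T'}=\{x\in T':\forall j<i\,(x\in T'_j\iff j\in\pi)\}$; set $\pi^{p_0}_T=T$, $\pi^{p_0}_{T'}=T'$. A position $p$ is a win for $\forall$ if there is a palette $\pi$ with $|\pi^p_T|\ne|\pi^p_{T'}|$ and ($|\pi^p_T|<2$ or $|\pi^p_{T'}|<2$). $\forall$ wins a play if some position of it is a win for him; otherwise $\exists$ wins. -}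

module Defs where

open import Data.Nat using (ℕ; zero; suc; _≤_)
open import Data.Bool using (Bool; true; false; _∧_)
open import Data.Bool.Properties using () renaming (_≟_ to _≟ᵇ_)
open import Data.List using (List; []; _∷_; _++_; [_]; take)
open import Data.Vec using (Vec; toList)
open import Data.Fin.Subset using (Subset)
open import Data.Product using (Σ; _×_; _,_)
open import Data.Sum using (_⊎_; inj₁; inj₂)
open import Function.Bundles using (_↔_)
open import Relation.Nullary using (¬_; does)
open import Relation.Binary.PropositionalEquality using (_≡_)

Sub : Set → Set
Sub T = T → Bool

Move : Set → Set → Set
Move T T' = Sub T ⊎ Sub T'

Reply : {T T' : Set} → Move T T' → Set
Reply {T} {T'} (inj₁ _) = Sub T'
Reply {T} {T'} (inj₂ _) = Sub T

combine : {T T' : Set} → (m : Move T T') → Reply m → Sub T × Sub T'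
combine (inj₁ A) B = A , B
combine (inj₂ B) A = A , B

Position : Set → Set → Set
Position T T' = List (Sub T × Sub T')

Strategy : Set → Set → Set
Strategy T T' = (p : Position T T') → (m : Move T T') → Reply m

run : {T T' : Set} → Strategy T T' → Position T T' → List (Move T T') → Position T T'
run σ p [] = p
run σ p (m ∷ ms) = run σ (p ++ [ combine m (σ p m) ]) ms

-- agreement of colours: for all j < length p, (x ∈ T_j ⇔ j ∈ π)
-- (π given as the list of its characteristic bits π(0), π(1), …)
agreeT : {T T' : Set} → List Bool → Position T T' → T → Bool
agreeT _ [] x = true
agreeT [] (_ ∷ _) x = true
agreeT (b ∷ bs) ((A , _) ∷ p) x = does (A x ≟ᵇ b) ∧ agreeT bs p x

agreeT' : {T T' : Set} → List Bool → Position T T' → T' → Bool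
agreeT' _ [] x = true
agreeT' [] (_ ∷ _) x = true
agreeT' (b ∷ bs) ((_ , B) ∷ p) x = does (B x ≟ᵇ b) ∧ agreeT' bs p x

ClassT : {T T' : Set} → (n : ℕ) → Subset n → Position T T' → Set
ClassT {T} n π p = Σ T λ x → agreeT (toList π) p x ≡ true

ClassT' : {T T' : Set} → (n : ℕ) → Subset n → Position T T' → Set
ClassT' {T} {T'} n π p = Σ T' λ x → agreeT' (toList π) p x ≡ true

AtMostOne : Set → Set
AtMostOne A = (a b : A) → a ≡ b

-- p is a win for ∀: some palette π with |π_T| ≠ |π_T'| and one of them < 2.
-- Equal cardinality = existence of a bijection.
AllWins : (n : ℕ) → (T T' : Set) → Position T T' → Set
AllWins n T T' p = Σ (Subset n) λ π →
  ¬ (ClassT {T} {T'} n π p ↔ ClassT' {T} {T'} n π p)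
  × (AtMostOne (ClassT {T} {T'} n π p) ⊎ AtMostOne (ClassT' {T} {T'} n π p))

ExistsWins : (n : ℕ) → (T T' : Set) → Set
ExistsWins n T T' = Σ (Strategy T T') λ σ →
  (ms : Vec (Move T T') n) → (i : ℕ) → i ≤ n →
  ¬ AllWins n T T' (take i (run σ [] (toList ms)))

-- ∃ keeps the invariant that, with k rounds still to be played, for every palette the
-- classes π_T and π_T' are either equinumerous or both of size at least 2^(k+1).  When ∀
-- splits a class X in two, ∃ splits the matching class Y: a part of X with fewer than 2^k
-- elements is copied exactly, and the complementary part of Y keeps at least 2^k elements
-- because |Y| ≥ 2^(k+1); both parts of X cannot be small since |X| ≥ 2^(k+1).  As
-- 2^(k+1) ≥ 2, no position satisfying the invariant is a win for ∀.  Sizes of possibly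
-- infinite sets are compared through injections from Fin; excluded middle decides which
-- case applies and lets ∃ pick her replies.

module Submission where

open import Defs
open import Data.Nat using (ℕ; zero; suc; _+_; _*_; _^_; _⊓_; _≤_; _<_; s≤s; z<s)
open import Data.Nat.Properties as ℕ using ()
open import Data.Fin using (Fin; zero; suc; inject≤)
open import Data.Fin.Properties as Fin using (+↔⊎)
open import Data.Bool using (Bool; true; false; not; if_then_else_; _∧_)
open import Data.Bool.Properties using (not-¬) renaming (_≟_ to _≟ᵇ_)
open import Data.List using (List; []; _∷_; _++_; [_]; _∷ʳ_; map; length; take; initLast; _∷ʳ′_)
open import Data.List.Properties as List using ()
open import Data.Vec using (Vec; toList)
open import Data.Vec.Properties as Vec using ()
open import Data.Fin.Subset using (Subset)
open import Data.Product using (Σ; ∃; ∃-syntax; _×_; _,_; proj₁; proj₂)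
open import Data.Sum using (_⊎_; inj₁; inj₂)
open import Data.Sum.Function.Propositional using (_⊎-↔_)
open import Data.Sum.Properties using (inj₁-injective; inj₂-injective)
open import Data.Empty using (⊥; ⊥-elim)
open import Function using (_∘_)
open import Function.Bundles using (_↔_; _↣_; _⇔_; Injection; Inverse; Equivalence; mk↣; mk↔ₛ′; mk⇔; mk⤖)
open import Function.Properties.Inverse using (↔-sym; ↔-trans; ↔⇒↣)
open import Function.Properties.Injection using (↣-trans)
open import Function.Properties.Bijection using (⤖⇒↔)
open import Function.Consequences.Propositional using (strictlySurjective⇒surjective)
open import Level using (0ℓ)
open import Axiom.ExcludedMiddle using (ExcludedMiddle)
open import Axiom.UniquenessOfIdentityProofs.WithK using (uip)
open import Relation.Nullary using (¬_; yes; no; does)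
open import Relation.Binary.PropositionalEquality hiding ([_])

private variable
  X Y S : Set
  M j : ℕ

Preimage : {C : Set} → (X → C) → C → Set
Preimage {X} f c = Σ X λ x → f x ≡ c

Preimage-≡ : {C : Set} {f : X → C} {c : C} {p q : Preimage f c} → proj₁ p ≡ proj₁ q → p ≡ q
Preimage-≡ {p = x , e} {q = .x , e'} refl = cong (x ,_) (uip e e')

Preimage-cong-⇔ : {B C : Set} {f : X → B} {g : X → C} {b : B} {c : C} →
                  (∀ x → f x ≡ b ⇔ g x ≡ c) → Preimage f b ↔ Preimage g c
Preimage-cong-⇔ f⇔g = mk↔ₛ′
  (λ (x , e) → x , Equivalence.to (f⇔g x) e)
  (λ (x , e) → x , Equivalence.from (f⇔g x) e)
  (λ _ → Preimage-≡ refl)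
  (λ _ → Preimage-≡ refl)

Preimage-cong : {C : Set} {f g : X → C} → f ≗ g → ∀ c → Preimage f c ↔ Preimage g c
Preimage-cong f≗g c = Preimage-cong-⇔ λ x → mk⇔ (trans (sym (f≗g x))) (trans (f≗g x))

Preimage-↔ : {C : Set} (X↔Y : X ↔ Y) (A : X → C) (c : C) →
             Preimage A c ↔ Preimage (A ∘ Inverse.from X↔Y) c
Preimage-↔ X↔Y A c = mk↔ₛ′
  (λ (x , e) → to x , trans (cong A (strictlyInverseʳ x)) e)
  (λ (y , e) → from y , e)
  (λ (y , _) → Preimage-≡ (strictlyInverseˡ y))
  (λ (x , _) → Preimage-≡ (strictlyInverseʳ x))
  where open Inverse X↔Y

↔-empty : ¬ X → ¬ Y → X ↔ Y
↔-empty ¬x ¬y = mk↔ₛ′ (⊥-elim ∘ ¬x) (⊥-elim ∘ ¬y) (⊥-elim ∘ ¬y) (⊥-elim ∘ ¬x)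

↣-partition : (A : X → Bool) → X ↣ (Preimage A true ⊎ Preimage A false)
↣-partition {X} A = mk↣ {to = λ x → sort x (A x) refl} λ {x} {y} e →
  trans (sym (forget∘sort x (A x) refl)) (trans (cong forget e) (forget∘sort y (A y) refl))
  where
  sort : (x : X) (b : Bool) → A x ≡ b → Preimage A true ⊎ Preimage A false
  sort x true  e = inj₁ (x , e)
  sort x false e = inj₂ (x , e)
  forget : Preimage A true ⊎ Preimage A false → X
  forget (inj₁ (x , _)) = x
  forget (inj₂ (x , _)) = x
  forget∘sort : ∀ x b (e : A x ≡ b) → forget (sort x b e) ≡ x
  forget∘sort x true  e = refl
  forget∘sort x false e = refl

↣-extend : (f : Fin M ↣ S) (x : S) → (∀ i → Injection.to f i ≢ x) → Fin (suc M) ↣ S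
↣-extend {M} {S} f x fresh = mk↣ {to = g} injective
  where
  g : Fin (suc M) → S
  g zero    = x
  g (suc i) = Injection.to f i
  injective : ∀ {i i'} → g i ≡ g i' → i ≡ i'
  injective {zero}  {zero}   _ = refl
  injective {zero}  {suc i'} e = ⊥-elim (fresh i' (sym e))
  injective {suc i} {zero}   e = ⊥-elim (fresh i e)
  injective {suc i} {suc i'} e = cong suc (Injection.injective f e)

inject≤-↣ : {m n : ℕ} → m ≤ n → Fin m ↣ Fin n
inject≤-↣ m≤n = mk↣ {to = λ i → inject≤ i m≤n} λ {i} {i'} → Fin.inject≤-injective m≤n m≤n i i'

↣-onto⇒↔ : (f : X ↣ Y) → (∀ y → ∃ λ x → Injection.to f x ≡ y) → X ↔ Y
↣-onto⇒↔ f onto = ⤖⇒↔ (mk⤖ (Injection.injective f , strictlySurjective⇒surjective onto))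

Alike : ℕ → Set → Set → Set
Alike M X Y = (X ↔ Y) ⊎ (Fin M ↣ X × Fin M ↣ Y)

Alike-sym : Alike M X Y → Alike M Y X
Alike-sym (inj₁ X↔Y)         = inj₁ (↔-sym X↔Y)
Alike-sym (inj₂ (bigX , bigY)) = inj₂ (bigY , bigX)

Alike-cong : {X' Y' : Set} → X ↔ X' → Y ↔ Y' → Alike M X Y → Alike M X' Y'
Alike-cong X↔X' Y↔Y' (inj₁ X↔Y)         = inj₁ (↔-trans (↔-sym X↔X') (↔-trans X↔Y Y↔Y'))
Alike-cong X↔X' Y↔Y' (inj₂ (bigX , bigY)) =
  inj₂ (↣-trans bigX (↔⇒↣ X↔X') , ↣-trans bigY (↔⇒↣ Y↔Y'))

↣⇒¬AtMostOne : 2 ≤ M → Fin M ↣ X → ¬ AtMostOne X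
↣⇒¬AtMostOne (s≤s (s≤s _)) f atMostOne with Injection.injective f {zero} {suc zero} (atMostOne _ _)
... | ()

Alike-unwinnable : 2 ≤ M → Alike M X Y → ¬ (X ↔ Y) → ¬ (AtMostOne X ⊎ AtMostOne Y)
Alike-unwinnable _   (inj₁ X↔Y)         X≉Y _          = X≉Y X↔Y
Alike-unwinnable 2≤M (inj₂ (bigX , _))  _   (inj₁ oneX) = ↣⇒¬AtMostOne 2≤M bigX oneX
Alike-unwinnable 2≤M (inj₂ (_ , bigY))  _   (inj₂ oneY) = ↣⇒¬AtMostOne 2≤M bigY oneY

classes-not-both-small : {j' : ℕ} (A : X → Bool) → Fin (2 * M) ↣ X → j < M → j' < M →
                         Fin j ↔ Preimage A true → Fin j' ↔ Preimage A false → ⊥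
classes-not-both-small {M = M} A big j<M j'<M small₁ small₀ =
  ℕ.<⇒≱ (ℕ.+-mono-< j<M (ℕ.<-≤-trans j'<M (ℕ.m≤m+n M 0)))
         (Fin.injective⇒≤ (Injection.injective count))
  where
  count = ↣-trans big (↣-trans (↣-partition A)
            (↣-trans (↔⇒↣ (↔-sym small₁ ⊎-↔ ↔-sym small₀)) (↔⇒↣ (↔-sym +↔⊎))))

colour : List (X → Bool) → X → List Bool
colour As x = map (λ A → A x) As

ClassesAlike : ℕ → List (X → Bool) → List (Y → Bool) → Set
ClassesAlike M As Bs = ∀ s → Alike M (Preimage (colour As) s) (Preimage (colour Bs) s)

ClassesAlike-sym : {As : List (X → Bool)} {Bs : List (Y → Bool)} →
                   ClassesAlike M As Bs → ClassesAlike M Bs As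
ClassesAlike-sym alike s = Alike-sym (alike s)

colour-∷ʳ : ∀ As (A : X → Bool) x → colour (As ++ [ A ]) x ≡ colour As x ∷ʳ A x
colour-∷ʳ As A x = List.map-++ (λ A → A x) As [ A ]

class-∷ʳ-[] : ∀ As (A : X → Bool) → ¬ Preimage (colour (As ++ [ A ])) []
class-∷ʳ-[] As A (x , e) with List.++-conicalʳ (colour As x) _ (trans (sym (colour-∷ʳ As A x)) e)
... | ()

class-∷ʳ : ∀ As (A : X → Bool) s b →
           Preimage (colour (As ++ [ A ])) (s ∷ʳ b) ↔ Preimage {Preimage (colour As) s} (A ∘ proj₁) b
class-∷ʳ As A s b = mk↔ₛ′
  (λ (x , e) → let e₁ , e₂ = List.∷ʳ-injective _ _ (trans (sym (colour-∷ʳ As A x)) e)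
               in (x , e₁) , e₂)
  (λ ((x , e₁) , e₂) → x , trans (colour-∷ʳ As A x) (cong₂ _∷ʳ_ e₁ e₂))
  (λ _ → Preimage-≡ (Preimage-≡ refl))
  (λ _ → Preimage-≡ refl)

take-length-++ : {A : Set} (xs ys : List A) → take (length xs) (xs ++ ys) ≡ xs
take-length-++ []       ys = refl
take-length-++ (x ∷ xs) ys = cong (x ∷_) (take-length-++ xs ys)

length-∷ʳ-+ : {A : Set} (xs : List A) (x : A) (k : ℕ) → length (xs ∷ʳ x) + k ≡ length xs + suc k
length-∷ʳ-+ xs x k = begin
  length (xs ∷ʳ x) + k ≡⟨ cong (_+ k) (List.length-++ xs) ⟩
  length xs + 1 + k    ≡⟨ ℕ.+-assoc (length xs) 1 k ⟩
  length xs + suc k    ∎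
  where open ≡-Reasoning

module _ {T T' : Set} (σ : Strategy T T') where

  run-extends : ∀ p ms → ∃ λ w → run σ p ms ≡ p ++ w
  run-extends p []       = [] , sym (List.++-identityʳ p)
  run-extends p (m ∷ ms) with w , e ← run-extends (p ∷ʳ combine m (σ p m)) ms
    = combine m (σ p m) ∷ w , trans e (List.++-assoc p _ w)

  take-run : ∀ p i ms → take (length p + i) (run σ p ms) ≡ run σ p (take i ms)
  take-run p zero    ms with w , e ← run-extends p ms = begin
    take (length p + 0) (run σ p ms) ≡⟨ cong₂ take (ℕ.+-identityʳ (length p)) e ⟩
    take (length p) (p ++ w)         ≡⟨ take-length-++ p w ⟩
    p                                ∎
    where open ≡-Reasoning
  take-run p (suc i) []       = List.take-all _ p (ℕ.m≤m+n (length p) (suc i))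
  take-run p (suc i) (m ∷ ms) = begin
    take (length p + suc i) (run σ p′ ms)
      ≡⟨ cong (λ l → take l (run σ p′ ms)) (sym (length-∷ʳ-+ p _ i)) ⟩
    take (length p′ + i) (run σ p′ ms)    ≡⟨ take-run p′ i ms ⟩
    run σ p′ (take i ms)                  ∎
    where open ≡-Reasoning
          p′ = p ∷ʳ combine m (σ p m)

≤-length-toList : {A : Set} {l n : ℕ} (v : Vec A n) → l ≤ n → l ≤ length (toList v)
≤-length-toList v l≤n = subst (_ ≤_) (sym (Vec.length-toList v)) l≤n

agree : List Bool → List (X → Bool) → X → Bool
agree (b ∷ bs) (A ∷ As) x = does (A x ≟ᵇ b) ∧ agree bs As x
agree _        _        _ = true

agreeT≡agree : {T T' : Set} (bs : List Bool) (p : Position T T') →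
               agreeT bs p ≗ agree bs (map proj₁ p)
agreeT≡agree []       []            x = refl
agreeT≡agree []       (_ ∷ _)       x = refl
agreeT≡agree (_ ∷ _)  []            x = refl
agreeT≡agree (b ∷ bs) ((A , _) ∷ p) x = cong (does (A x ≟ᵇ b) ∧_) (agreeT≡agree bs p x)

agreeT'≡agree : {T T' : Set} (bs : List Bool) (p : Position T T') →
                agreeT' bs p ≗ agree bs (map proj₂ p)
agreeT'≡agree []       []            x = refl
agreeT'≡agree []       (_ ∷ _)       x = refl
agreeT'≡agree (_ ∷ _)  []            x = refl
agreeT'≡agree (b ∷ bs) ((_ , B) ∷ p) x = cong (does (B x ≟ᵇ b) ∧_) (agreeT'≡agree bs p x)

agree⇔colour : ∀ bs (As : List (X → Bool)) {l} x → length As ≡ l → l ≤ length bs →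
               (agree bs As x ≡ true) ⇔ (colour As x ≡ take l bs)
agree⇔colour []       []       x refl _ = mk⇔ (λ _ → refl) (λ _ → refl)
agree⇔colour (_ ∷ _)  []       x refl _ = mk⇔ (λ _ → refl) (λ _ → refl)
agree⇔colour (b ∷ bs) (A ∷ As) x refl (s≤s le) with A x ≟ᵇ b
... | yes Ax≡b =
  mk⇔ (cong₂ _∷_ Ax≡b ∘ Equivalence.to ih) (Equivalence.from ih ∘ List.∷-injectiveʳ)
  where ih = agree⇔colour bs As x refl le
... | no  Ax≢b = mk⇔ (λ ()) (⊥-elim ∘ Ax≢b ∘ List.∷-injectiveˡ)

module _ (lem : ExcludedMiddle 0ℓ) where

  epsilon : X → (P : X → Set) → Σ X λ x → (∃ P → P x)
  epsilon x₀ P with lem {∃ P}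
  ... | yes (x , Px) = x , λ _ → Px
  ... | no  ¬∃P      = x₀ , λ ∃P → ⊥-elim (¬∃P ∃P)

  injection-or-fewer : ∀ M → (Fin M ↣ S) ⊎ (∃[ j ] j < M × Fin j ↔ S)
  injection-or-fewer zero = inj₁ (mk↣ {to = λ ()} λ { {()} })
  injection-or-fewer (suc M) with injection-or-fewer M
  ... | inj₂ (j , j<M , Fin-j↔S) = inj₂ (j , ℕ.m<n⇒m<1+n j<M , Fin-j↔S)
  ... | inj₁ f with lem {∃ λ x → ∀ i → Injection.to f i ≢ x}
  ...   | yes (x , fresh) = inj₁ (↣-extend f x fresh)
  ...   | no  ¬fresh      = inj₂ (M , ℕ.n<1+n M , ↣-onto⇒↔ f onto)
    where
    onto : ∀ x → ∃ λ i → Injection.to f i ≡ x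
    onto x with lem {∃ λ i → Injection.to f i ≡ x}
    ... | yes hit  = hit
    ... | no  miss = ⊥-elim (¬fresh (x , λ i e → miss (i , e)))

  indicator : Bool → (Y → Set) → Y → Bool
  indicator b P y = if does (lem {P y}) then b else not b

  indicator-holds : ∀ b (P : Y → Set) {y} → P y → indicator b P y ≡ b
  indicator-holds b P {y} Py with lem {P y}
  ... | yes _  = refl
  ... | no ¬Py = ⊥-elim (¬Py Py)

  indicator-fails : ∀ b (P : Y → Set) {y} → ¬ P y → indicator b P y ≡ not b
  indicator-fails b P {y} ¬Py with lem {P y}
  ... | yes Py = ⊥-elim (¬Py Py)
  ... | no _   = refl

  indicator⇒holds : ∀ b (P : Y → Set) {y} → indicator b P y ≡ b → P y
  indicator⇒holds b P {y} e with lem {P y}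
  ... | yes Py = Py
  ... | no _   = ⊥-elim (not-¬ refl (sym e))

  split-↣ : Fin (2 * M) ↣ Y → j ≤ M → ∀ b →
            Σ (Y → Bool) λ B → (Fin j ↔ Preimage B b) × (Fin M ↣ Preimage B (not b))
  split-↣ {M} {Y} {j} big j≤M b = B , exact , rest
    where
    j+M≤2M : j + M ≤ 2 * M
    j+M≤2M = ℕ.+-mono-≤ j≤M (ℕ.m≤m+n M 0)
    g : (Fin j ⊎ Fin M) ↣ Y
    g = ↣-trans (↔⇒↣ (↔-sym (+↔⊎ {j} {M}))) (↣-trans (inject≤-↣ j+M≤2M) big)
    emb : Fin j ⊎ Fin M → Y
    emb = Injection.to g
    InLeft : Y → Set
    InLeft y = ∃ λ i → emb (inj₁ i) ≡ y
    B : Y → Bool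
    B = indicator b InLeft
    exact : Fin j ↔ Preimage B b
    exact = mk↔ₛ′
      (λ i → emb (inj₁ i) , indicator-holds b InLeft (i , refl))
      (λ (y , e) → proj₁ (indicator⇒holds b InLeft e))
      (λ (y , e) → Preimage-≡ (proj₂ (indicator⇒holds b InLeft e)))
      (λ i → inj₁-injective (Injection.injective g (proj₂ (indicator⇒holds b InLeft _))))
    notInLeft : ∀ i → ¬ InLeft (emb (inj₂ i))
    notInLeft i (i' , e) with Injection.injective g {inj₁ i'} {inj₂ i} e
    ... | ()
    rest : Fin M ↣ Preimage B (not b)
    rest = mk↣ {to = λ i → emb (inj₂ i) , indicator-fails b InLeft (notInLeft i)}
                (inj₂-injective ∘ Injection.injective g ∘ cong proj₁)

  Alike-split : Alike (2 * M) X Y → (A : X → Bool) →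
                Σ (Y → Bool) λ B → ∀ b → Alike M (Preimage A b) (Preimage B b)
  Alike-split (inj₁ X↔Y) A = A ∘ Inverse.from X↔Y , λ b → inj₁ (Preimage-↔ X↔Y A b)
  Alike-split {M} (inj₂ (bigX , bigY)) A
    with injection-or-fewer {S = Preimage A true} M | injection-or-fewer {S = Preimage A false} M
  ... | inj₁ big₁ | inj₁ big₀
      with B , exact , rest ← split-↣ bigY ℕ.≤-refl true
      = B , λ { true → inj₂ (big₁ , ↔⇒↣ exact) ; false → inj₂ (big₀ , rest) }
  ... | inj₁ big₁ | inj₂ (j , j<M , small₀)
      with B , exact , rest ← split-↣ bigY (ℕ.<⇒≤ j<M) false
      = B , λ { true → inj₂ (big₁ , rest) ; false → inj₁ (↔-trans (↔-sym small₀) exact) }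
  ... | inj₂ (j , j<M , small₁) | inj₁ big₀
      with B , exact , rest ← split-↣ bigY (ℕ.<⇒≤ j<M) true
      = B , λ { true → inj₁ (↔-trans (↔-sym small₁) exact) ; false → inj₂ (big₀ , rest) }
  ... | inj₂ (_ , j<M , small₁) | inj₂ (_ , j'<M , small₀) =
      ⊥-elim (classes-not-both-small A bigX j<M j'<M small₁ small₀)

  ClassesAlike-refine : {As : List (X → Bool)} {Bs : List (Y → Bool)} →
                        ClassesAlike (2 * M) As Bs → (A : X → Bool) →
                        Σ (Y → Bool) λ B → ClassesAlike M (As ++ [ A ]) (Bs ++ [ B ])
  ClassesAlike-refine {Y = Y} {M = M} {As = As} {Bs = Bs} alike A = B , refined
    where
    splitClass : ∀ s → Σ (Preimage (colour Bs) s → Bool) λ Bₛ →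
                 ∀ b → Alike M (Preimage (A ∘ proj₁) b) (Preimage Bₛ b)
    splitClass s = Alike-split (alike s) (A ∘ proj₁)
    B : Y → Bool
    B y = proj₁ (splitClass (colour Bs y)) (y , refl)
    B-on-class : ∀ s (z : Preimage (colour Bs) s) → B (proj₁ z) ≡ proj₁ (splitClass s) z
    B-on-class s (y , refl) = refl
    refined : ClassesAlike M (As ++ [ A ]) (Bs ++ [ B ])
    refined s′ with initLast s′
    ... | []       = inj₁ (↔-empty (class-∷ʳ-[] As A) (class-∷ʳ-[] Bs B))
    ... | s ∷ʳ′ b = Alike-cong (↔-sym (class-∷ʳ As A s b))
                      (↔-sym (↔-trans (class-∷ʳ Bs B s b) (Preimage-cong (B-on-class s) b)))
                      (proj₂ (splitClass s) b)

  module Play (n : ℕ) (T T' : Set) where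

    PositionAlike : ℕ → Position T T' → Set
    PositionAlike M p = ClassesAlike M (map proj₁ p) (map proj₂ p)

    PositionAlike-∷ʳ : ∀ p {A B} → ClassesAlike M (map proj₁ p ∷ʳ A) (map proj₂ p ∷ʳ B) →
                       PositionAlike M (p ∷ʳ (A , B))
    PositionAlike-∷ʳ p =
      subst₂ (ClassesAlike _) (sym (List.map-++ proj₁ p _)) (sym (List.map-++ proj₂ p _))

    respond : ∀ p → PositionAlike (2 * M) p → (m : Move T T') →
              Σ (Reply m) λ r → PositionAlike M (p ∷ʳ combine m r)
    respond p alike (inj₁ A) with B , alike′ ← ClassesAlike-refine alike A =
      B , PositionAlike-∷ʳ p alike′
    respond p alike (inj₂ B) with A , alike′ ← ClassesAlike-refine (ClassesAlike-sym alike) B =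
      A , PositionAlike-∷ʳ p (ClassesAlike-sym alike′)

    Safe : Position T T' → Set
    Safe p = ∃[ k ] length p + k ≡ n × PositionAlike (2 ^ suc k) p

    defaultReply : (m : Move T T') → Reply m
    defaultReply (inj₁ _) _ = false
    defaultReply (inj₂ _) _ = false

    SafeReply : (p : Position T T') (m : Move T T') → Reply m → Set
    SafeReply p m r = Safe (p ∷ʳ combine m r)

    strategy : Strategy T T'
    strategy p m = proj₁ (epsilon (defaultReply m) (SafeReply p m))

    strategy-safe : ∀ p m → length p < n → Safe p → Safe (p ∷ʳ combine m (strategy p m))
    strategy-safe p m l<n (zero , l+0≡n , _) =
      ⊥-elim (ℕ.<-irrefl (trans (sym (ℕ.+-identityʳ (length p))) l+0≡n) l<n)
    strategy-safe p m _ (suc k , l+1+k≡n , alike) with r , alike′ ← respond {M = 2 ^ suc k} p alike m =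
      proj₂ (epsilon (defaultReply m) (SafeReply p m))
            (r , k , trans (length-∷ʳ-+ p _ k) l+1+k≡n , alike′)

    run-safe : ∀ p ms → length p + length ms ≤ n → Safe p → Safe (run strategy p ms)
    run-safe p []       _     safe = safe
    run-safe p (m ∷ ms) bound safe =
      run-safe (p ∷ʳ c) ms (subst (_≤ n) (sym (length-∷ʳ-+ p c (length ms))) bound)
               (strategy-safe p m (ℕ.<-≤-trans (ℕ.m<m+n (length p) z<s) bound) safe)
      where c = combine m (strategy p m)

    initially-safe : Fin (2 ^ suc n) ↣ T → Fin (2 ^ suc n) ↣ T' → Safe []
    initially-safe f f′ = n , refl , alike
      where
      whole : {S : Set} → Fin (2 ^ suc n) ↣ S → Fin (2 ^ suc n) ↣ Preimage (colour {X = S} []) []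
      whole g = mk↣ {to = λ i → Injection.to g i , refl} (Injection.injective g ∘ cong proj₁)
      alike : PositionAlike (2 ^ suc n) []
      alike []      = inj₂ (whole f , whole f′)
      alike (_ ∷ _) = inj₁ (↔-empty (λ { (_ , ()) }) (λ { (_ , ()) }))

    play-safe : Fin (2 ^ suc n) ↣ T → Fin (2 ^ suc n) ↣ T' →
                ∀ (ms : Vec (Move T T') n) i → Safe (take i (run strategy [] (toList ms)))
    play-safe f f′ ms i = subst Safe (sym (take-run strategy [] i (toList ms)))
      (run-safe [] (take i (toList ms)) bound (initially-safe f f′))
      where
      bound : length (take i (toList ms)) ≤ n
      bound = begin
        length (take i (toList ms)) ≡⟨ List.length-take i (toList ms) ⟩
        i ⊓ length (toList ms)      ≤⟨ ℕ.m⊓n≤n i _ ⟩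
        length (toList ms)          ≡⟨ Vec.length-toList ms ⟩
        n                           ∎
        where open ℕ.≤-Reasoning

    ClassT↔ : ∀ (π : Subset n) p → length p ≤ n →
              ClassT {T} {T'} n π p ↔ Preimage (colour (map proj₁ p)) (take (length p) (toList π))
    ClassT↔ π p p≤n =
      ↔-trans (Preimage-cong (agreeT≡agree (toList π) p) true) (Preimage-cong-⇔ λ x →
      agree⇔colour (toList π) (map proj₁ p) x (List.length-map proj₁ p) (≤-length-toList π p≤n))

    ClassT'↔ : ∀ (π : Subset n) p → length p ≤ n →
               ClassT' {T} {T'} n π p ↔ Preimage (colour (map proj₂ p)) (take (length p) (toList π))
    ClassT'↔ π p p≤n =
      ↔-trans (Preimage-cong (agreeT'≡agree (toList π) p) true) (Preimage-cong-⇔ λ x →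
      agree⇔colour (toList π) (map proj₂ p) x (List.length-map proj₂ p) (≤-length-toList π p≤n))

    safe-unwinnable : ∀ p → Safe p → ¬ AllWins n T T' p
    safe-unwinnable p (k , l+k≡n , alike) (π , ¬T↔T' , small) =
      Alike-unwinnable (ℕ.*-monoʳ-≤ 2 (ℕ.m^n>0 2 k))
        (Alike-cong (↔-sym (ClassT↔ π p p≤n)) (↔-sym (ClassT'↔ π p p≤n))
                    (alike (take (length p) (toList π))))
        ¬T↔T' small
      where p≤n = subst (length p ≤_) l+k≡n (ℕ.m≤m+n (length p) k)

lemma4p3 : ExcludedMiddle 0ℓ → (n : ℕ) → (T T' : Set) →
    Fin (2 ^ suc n) ↣ T → Fin (2 ^ suc n) ↣ T' → ExistsWins n T T'
lemma4p3 lem n T T' f f′ = strategy , λ ms i _ → safe-unwinnable _ (play-safe f f′ ms i)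
  where open Play lem n T T'
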